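{- Let $T$ be a tensor over variable sets $X,Y,Z$ with partitions of $X,Y,Z$ into equal-size parts, with sets of parts $\mathcal P_X,\mathcal P_Y,\mathcal P_Z$, and suppose $T$ satisfies the Property below with a set of permutations $\mathcal G$. Then for any sets of parts $P_X,P_X'\subseteq\mathcal P_X$, $P_Y,P_Y'\subseteq\mathcal P_Y$, $P_Z,P_Z'\subseteq \mathcal P_Z$, there exists $(\pi_X,\pi_Y,\pi_Z)\in\mathcal G$ such that $|P_X\cap\pi_X(P_X')|\le \frac{4|P_X|\,|P_X'|}{|\mathcal P_X|}$, $|P_Y\cap\pi_Y(P_Y')|\le \frac{4|P_Y|\,|P_Y'|}{|\mathcal P_Y|}$, and $|P_Z\cap\pi_Z(P_Z')|\le \frac{4|P_Z|\,|P_Z'|}{|\mathcal P_Z|}$.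
   Context: Here $\pi_X(P_X')$ denotes the set of parts $\{\pi_X(X_t):X_t\in P_X'\}$. Let $M_X=|\mathcal P_X|$, $M_Y=|\mathcal P_Y|$, $M_Z=|\mathcal P_Z|$. Property: $\mathcal G$ is a set of triples $(\pi_X,\pi_Y,\pi_Z)$ of permutations of $X,Y,Z$ respectively such that (1) each $\pi_X$ maps every part onto some entire part (similarly for $Y,Z$), thus inducing permutations of $\mathcal P_X,\mathcal P_Y,\mathcal P_Z$; (2) for all variables $x,y,z$, the coefficient of $xyz$ in $T$ equals the coefficient of $\pi_X(x)\pi_Y(y)\pi_Z(z)$ in $T$; (3) for uniformly random $(\pi_X,\pi_Y,\pi_Z)\in\mathcal G$ and any parts $X_t,X_{t'}$, $Y_t,Y_{t'}$, $Z_t,Z_{t'}$: $\Pr[\pi_X(X_t)=X_{t'}]=1/M_X$, $\Pr[\pi_Y(Y_t)=Y_{t'}]=1/M_Y$, $\Pr[\pi_Z(Z_t)=Z_{t'}]=1/M_Z$. -}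

module Defs where

open import Level using (Level)
open import Data.Nat using (ℕ; zero; suc; _*_; _≤_)
open import Data.Bool using (Bool; true; false; _∧_; _∨_)
open import Data.Fin using (Fin; zero; suc; _≟_)
open import Data.Fin.Subset using (Subset; _∩_; ∣_∣)
open import Data.Fin.Permutation using (Permutation′; _⟨$⟩ʳ_)
open import Data.Vec using (tabulate; lookup)
open import Data.Product using (Σ; ∃; _×_; _,_; proj₁)
open import Relation.Nullary.Decidable using (⌊_⌋)
open import Relation.Binary.PropositionalEquality using (_≡_)

anyᵇ : ∀ {n} → (Fin n → Bool) → Bool
anyᵇ {zero} f = false
anyᵇ {suc n} f = f zero ∨ anyᵇ (λ i → f (suc i))

count : ∀ {n} → (Fin n → Bool) → ℕ
count f = ∣ tabulate f ∣

-- A partition of the variable set Fin n into M parts is given by the map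
-- `part` sending each variable to (the index of) its part.
-- All parts have the same size s (and s ≥ 1 is required separately, so parts are nonempty).
EqualParts : ∀ {n M} → (Fin n → Fin M) → ℕ → Set
EqualParts part s = ∀ t → count (λ x → ⌊ part x ≟ t ⌋) ≡ s

MapsPartOnto : ∀ {n M} → (Fin n → Fin M) → Permutation′ n → Fin M → Fin M → Set
MapsPartOnto part π t t' =
  (∀ x → part x ≡ t → part (π ⟨$⟩ʳ x) ≡ t') ×
  (∀ y → part y ≡ t' → ∃ λ x → part x ≡ t × π ⟨$⟩ʳ x ≡ y)

RespectsParts : ∀ {n M} → (Fin n → Fin M) → Permutation′ n → Set
RespectsParts {M = M} part π = ∀ t → Σ (Fin M) λ t' → MapsPartOnto part π t t'

-- The induced map on parts (well defined, since parts are nonempty).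
induced : ∀ {n M} (part : Fin n → Fin M) (π : Permutation′ n) →
          RespectsParts part π → Fin M → Fin M
induced part π c t = proj₁ (c t)

image : ∀ {M} → (Fin M → Fin M) → Subset M → Subset M
image σ P' = tabulate (λ t → anyᵇ (λ t' → lookup P' t' ∧ ⌊ σ t' ≟ t ⌋))

record Triple (nX nY nZ : ℕ) : Set where
  constructor triple
  field
    πX : Permutation′ nX
    πY : Permutation′ nY
    πZ : Permutation′ nZ
open Triple public

-- G : Fin k → Triple enumerates a *set* of triples: distinct indices give
-- (extensionally) distinct triples.
DistinctTriples : ∀ {k nX nY nZ} → (Fin k → Triple nX nY nZ) → Set
DistinctTriples {k} G = ∀ (i j : Fin k) →
  (∀ x → πX (G i) ⟨$⟩ʳ x ≡ πX (G j) ⟨$⟩ʳ x) →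
  (∀ y → πY (G i) ⟨$⟩ʳ y ≡ πY (G j) ⟨$⟩ʳ y) →
  (∀ z → πZ (G i) ⟨$⟩ʳ z ≡ πZ (G j) ⟨$⟩ʳ z) → i ≡ j

-- Condition (3) on one coordinate: for uniformly random i : Fin k,
-- Pr[π(X_t) = X_t'] = 1/M, i.e. #{i | σ_i(t) = t'} * M = k.
UniformOnParts : ∀ {k M} → (Fin k → Fin M → Fin M) → Set
UniformOnParts {k} {M} σ = ∀ t t' → count (λ i → ⌊ σ i t ≟ t' ⌋) * M ≡ k

-- |P ∩ σ(P')| ≤ 4 |P| |P'| / M, multiplied through by M.
IntersectionBound : ∀ {M} → (Fin M → Fin M) → Subset M → Subset M → Set
IntersectionBound {M} σ P P' = ∣ P ∩ image σ P' ∣ * M ≤ 4 * ∣ P ∣ * ∣ P' ∣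

-- For one coordinate, |P ∩ σ(P')| is at most the number of pairs
-- (t, t') ∈ P × P' with σ t' = t; averaged over the uniform family σ this is |P| |P'| / M,
-- since each pair is hit by exactly k / M of the maps. By Markov's inequality at most a
-- quarter of the indices exceed four times the average, so some index is good in all
-- three coordinates at once.
module Submission where

open import Defs
open import Level using (Level)
open import Data.Nat.Properties hiding (_≟_)
open import Algebra.Properties.Semiring.Sum +-*-semiring
  using (sum; sum-syntax; sum-cong-≗; ∑-comm; ∑-distrib-+; *-distribˡ-sum; *-distribʳ-sum)
open import Data.Bool using (Bool; true; false; _∧_)
open import Data.Fin using (Fin; zero; suc; _≟_)
open import Data.Fin.Permutation using (_⟨$⟩ʳ_)
open import Data.Fin.Subset using (Subset; _∩_; ∣_∣)
open import Data.Nat using (ℕ; zero; suc; _+_; _*_; _≤_; _<_; z≤n; s≤s; _<?_)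
open import Data.Product using (∃; _×_; _,_)
open import Data.Vec using ([]; _∷_; tabulate; lookup)
open import Data.Vec.Properties using (lookup∘tabulate)
open import Function using (_∘_)
open import Relation.Nullary using (yes; no)
open import Relation.Nullary.Decidable using (⌊_⌋)
open import Relation.Binary.PropositionalEquality

𝟙 : Bool → ℕ
𝟙 true = 1
𝟙 false = 0

𝟙-∧ : ∀ a b → 𝟙 (a ∧ b) ≡ 𝟙 a * 𝟙 b
𝟙-∧ true b = sym (+-identityʳ (𝟙 b))
𝟙-∧ false b = refl

∑-mono-≤ : ∀ {n} {f g : Fin n → ℕ} → (∀ i → f i ≤ g i) → sum f ≤ sum g
∑-mono-≤ {zero} f≤g = z≤n
∑-mono-≤ {suc n} f≤g = +-mono-≤ (f≤g zero) (∑-mono-≤ (f≤g ∘ suc))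

∑-*-∑ : ∀ {m n} (f : Fin m → ℕ) (g : Fin n → ℕ) →
        ∑[ i < m ] ∑[ j < n ] (f i * g j) ≡ sum f * sum g
∑-*-∑ f g = begin
  ∑[ i < _ ] ∑[ j < _ ] (f i * g j)  ≡⟨ sum-cong-≗ (λ i → *-distribˡ-sum (f i) g) ⟨
  ∑[ i < _ ] (f i * sum g)           ≡⟨ *-distribʳ-sum (sum g) f ⟨
  sum f * sum g                      ∎
  where open ≡-Reasoning

∑<n⇒∃≡0 : ∀ {n} (f : Fin n → ℕ) → sum f < n → ∃ λ i → f i ≡ 0
∑<n⇒∃≡0 {suc n} f ∑f<n with f zero in f₀≡
... | zero = zero , f₀≡
... | suc a with ∑<n⇒∃≡0 (f ∘ suc) (≤-trans (s≤s (m≤n+m _ a)) (≤-pred ∑f<n))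
...   | i , fᵢ≡0 = suc i , fᵢ≡0

∣p∣≡∑ : ∀ {n} (p : Subset n) → ∣ p ∣ ≡ ∑[ i < n ] 𝟙 (lookup p i)
∣p∣≡∑ [] = refl
∣p∣≡∑ (true ∷ p) = cong suc (∣p∣≡∑ p)
∣p∣≡∑ (false ∷ p) = ∣p∣≡∑ p

count≡∑ : ∀ {n} (f : Fin n → Bool) → count f ≡ ∑[ i < n ] 𝟙 (f i)
count≡∑ f = trans (∣p∣≡∑ (tabulate f)) (sum-cong-≗ (cong 𝟙 ∘ lookup∘tabulate f))

𝟙-anyᵇ≤∑ : ∀ {n} (f : Fin n → Bool) → 𝟙 (anyᵇ f) ≤ ∑[ i < n ] 𝟙 (f i)
𝟙-anyᵇ≤∑ {zero} f = z≤n
𝟙-anyᵇ≤∑ {suc n} f with f zero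
... | true = s≤s z≤n
... | false = 𝟙-anyᵇ≤∑ (f ∘ suc)

lookup-∩ : ∀ {n} (p q : Subset n) i → lookup (p ∩ q) i ≡ (lookup p i ∧ lookup q i)
lookup-∩ (x ∷ p) (y ∷ q) zero = refl
lookup-∩ (x ∷ p) (y ∷ q) (suc i) = lookup-∩ p q i

markov : ∀ {k} (f : Fin k → ℕ) d → (∑[ i < k ] 𝟙 ⌊ d <? f i ⌋) * suc d ≤ sum f
markov {k} f d = begin
  (∑[ i < k ] 𝟙 ⌊ d <? f i ⌋) * suc d  ≡⟨ *-distribʳ-sum (suc d) (λ i → 𝟙 ⌊ d <? f i ⌋) ⟩
  ∑[ i < k ] (𝟙 ⌊ d <? f i ⌋ * suc d)  ≤⟨ ∑-mono-≤ (λ i → exceeding (f i)) ⟩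
  sum f                                ∎
  where
  open ≤-Reasoning
  exceeding : ∀ x → 𝟙 ⌊ d <? x ⌋ * suc d ≤ x
  exceeding x with d <? x
  ... | yes d<x = ≤-trans (≤-reflexive (+-identityʳ (suc d))) d<x
  ... | no _ = z≤n

N[1+4c]≤kc⇒4N≤k : ∀ N k c → N * suc (4 * c) ≤ k * c → 4 * N ≤ k
N[1+4c]≤kc⇒4N≤k N k c N[1+4c]≤kc = *-cancelʳ-≤ (4 * N) k (suc (4 * c)) (begin
  4 * N * suc (4 * c)    ≡⟨ *-assoc 4 N _ ⟩
  4 * (N * suc (4 * c))  ≤⟨ *-monoʳ-≤ 4 N[1+4c]≤kc ⟩
  4 * (k * c)            ≡⟨ *-comm 4 (k * c) ⟩
  k * c * 4              ≡⟨ *-assoc k c 4 ⟩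
  k * (c * 4)            ≡⟨ cong (k *_) (*-comm c 4) ⟩
  k * (4 * c)            ≤⟨ *-monoʳ-≤ k (n≤1+n _) ⟩
  k * suc (4 * c)        ∎)
  where open ≤-Reasoning

-- Union bound: three sets of density at most 1/4 cannot cover Fin k.
∃-common-zero : ∀ {k} (f g h : Fin k → ℕ) → 0 < k →
  4 * sum f ≤ k → 4 * sum g ≤ k → 4 * sum h ≤ k →
  ∃ λ i → f i ≡ 0 × g i ≡ 0 × h i ≡ 0
∃-common-zero {k} f g h 0<k 4∑f≤k 4∑g≤k 4∑h≤k
  with ∑<n⇒∃≡0 (λ i → f i + g i + h i) (*-cancelˡ-< 4 _ _ 4∑<4k)
  where
  4∑<4k : 4 * ∑[ i < k ] (f i + g i + h i) < 4 * k
  4∑<4k = begin-strict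
    4 * ∑[ i < k ] (f i + g i + h i)
      ≡⟨ cong (4 *_) (trans (∑-distrib-+ _ h) (cong (_+ sum h) (∑-distrib-+ f g))) ⟩
    4 * (sum f + sum g + sum h)
      ≡⟨ trans (*-distribˡ-+ 4 (sum f + sum g) (sum h)) (cong (_+ 4 * sum h) (*-distribˡ-+ 4 (sum f) (sum g))) ⟩
    4 * sum f + 4 * sum g + 4 * sum h  ≤⟨ +-mono-≤ (+-mono-≤ 4∑f≤k 4∑g≤k) 4∑h≤k ⟩
    k + k + k                          <⟨ m<n+m (k + k + k) 0<k ⟩
    k + (k + k + k)                    ≡⟨ cong (k +_) (trans (+-assoc k k k) (cong (λ x → k + (k + x)) (sym (+-identityʳ k)))) ⟩
    4 * k                              ∎
    where open ≤-Reasoning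
... | i , sum≡0 = i , m+n≡0⇒m≡0 (f i) fg≡0 , m+n≡0⇒n≡0 (f i) fg≡0 , m+n≡0⇒n≡0 (f i + g i) sum≡0
  where fg≡0 = m+n≡0⇒m≡0 (f i + g i) sum≡0

module _ {M : ℕ} where

  pairs : (Fin M → Fin M) → Subset M → Subset M → ℕ
  pairs σ P P' =
    ∑[ t < M ] (𝟙 (lookup P t) * ∑[ t' < M ] (𝟙 (lookup P' t') * 𝟙 ⌊ σ t' ≟ t ⌋))

  ∣P∩imageP'∣≤pairs : ∀ σ P P' → ∣ P ∩ image σ P' ∣ ≤ pairs σ P P'
  ∣P∩imageP'∣≤pairs σ P P' = ≤-trans (≤-reflexive (∣p∣≡∑ (P ∩ image σ P'))) (∑-mono-≤ pointwise)
    where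
    pointwise : ∀ t → 𝟙 (lookup (P ∩ image σ P') t) ≤
                      𝟙 (lookup P t) * ∑[ t' < M ] (𝟙 (lookup P' t') * 𝟙 ⌊ σ t' ≟ t ⌋)
    pointwise t = begin
      𝟙 (lookup (P ∩ image σ P') t)
        ≡⟨ trans (cong 𝟙 (lookup-∩ P _ t)) (𝟙-∧ (lookup P t) _) ⟩
      𝟙 (lookup P t) * 𝟙 (lookup (image σ P') t)
        ≡⟨ cong (λ b → 𝟙 (lookup P t) * 𝟙 b) (lookup∘tabulate _ t) ⟩
      𝟙 (lookup P t) * 𝟙 (anyᵇ (λ t' → lookup P' t' ∧ ⌊ σ t' ≟ t ⌋))
        ≤⟨ *-monoʳ-≤ (𝟙 (lookup P t)) (𝟙-anyᵇ≤∑ {M} _) ⟩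
      𝟙 (lookup P t) * ∑[ t' < M ] 𝟙 (lookup P' t' ∧ ⌊ σ t' ≟ t ⌋)
        ≡⟨ cong (𝟙 (lookup P t) *_) (sum-cong-≗ (λ t' → 𝟙-∧ (lookup P' t') _)) ⟩
      𝟙 (lookup P t) * ∑[ t' < M ] (𝟙 (lookup P' t') * 𝟙 ⌊ σ t' ≟ t ⌋)  ∎
      where open ≤-Reasoning

  -- Double counting: each pair (t, t') is hit by exactly k / M of the maps σ i.
  ∑pairs*M≡ : ∀ {k} (σ : Fin k → Fin M → Fin M) → UniformOnParts σ → ∀ P P' →
              (∑[ i < k ] pairs (σ i) P P') * M ≡ k * (∣ P ∣ * ∣ P' ∣)
  ∑pairs*M≡ {k} σ uniform P P' = begin
    (∑[ i < k ] ∑[ t < M ] (a t * ∑[ t' < M ] (b t' * hit i t t'))) * M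
      ≡⟨ cong (_* M) (sum-cong-≗ (λ i → sum-cong-≗ (λ t → *-distribˡ-sum (a t) (λ t' → b t' * hit i t t')))) ⟩
    (∑[ i < k ] ∑[ t < M ] ∑[ t' < M ] term i t t') * M
      ≡⟨ cong (_* M) (trans (∑-comm (λ i t → ∑[ t' < M ] term i t t')) (sum-cong-≗ (λ t → ∑-comm (λ i t' → term i t t')))) ⟩
    (∑[ t < M ] ∑[ t' < M ] ∑[ i < k ] term i t t') * M
      ≡⟨ cong (_* M) (sum-cong-≗ (λ t → sum-cong-≗ (λ t' → pull-out t t'))) ⟨
    (∑[ t < M ] ∑[ t' < M ] (a t * (b t' * hits t t'))) * M
      ≡⟨ trans (*-distribʳ-sum M (λ t → ∑[ t' < M ] (a t * (b t' * hits t t'))))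
               (sum-cong-≗ (λ t → *-distribʳ-sum M (λ t' → a t * (b t' * hits t t')))) ⟩
    ∑[ t < M ] ∑[ t' < M ] (a t * (b t' * hits t t') * M)
      ≡⟨ sum-cong-≗ (λ t → sum-cong-≗ (λ t' → times-M t t')) ⟩
    ∑[ t < M ] ∑[ t' < M ] (a t * (b t' * k))
      ≡⟨ ∑-*-∑ a (λ t' → b t' * k) ⟩
    sum a * ∑[ t' < M ] (b t' * k)
      ≡⟨ cong (sum a *_) (*-distribʳ-sum k b) ⟨
    sum a * (sum b * k)
      ≡⟨ trans (sym (*-assoc (sum a) (sum b) k)) (*-comm (sum a * sum b) k) ⟩
    k * (sum a * sum b)
      ≡⟨ cong₂ (λ x y → k * (x * y)) (∣p∣≡∑ P) (∣p∣≡∑ P') ⟨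
    k * (∣ P ∣ * ∣ P' ∣) ∎
    where
    open ≡-Reasoning
    a b : Fin M → ℕ
    a t = 𝟙 (lookup P t)
    b t' = 𝟙 (lookup P' t')
    hit : Fin k → Fin M → Fin M → ℕ
    hit i t t' = 𝟙 ⌊ σ i t' ≟ t ⌋
    hits : Fin M → Fin M → ℕ
    hits t t' = ∑[ i < k ] hit i t t'
    term : Fin k → Fin M → Fin M → ℕ
    term i t t' = a t * (b t' * hit i t t')

    pull-out : ∀ t t' → a t * (b t' * hits t t') ≡ ∑[ i < k ] term i t t'
    pull-out t t' = trans (cong (a t *_) (*-distribˡ-sum (b t') (λ i → hit i t t')))
                          (*-distribˡ-sum (a t) (λ i → b t' * hit i t t'))

    times-M : ∀ t t' → a t * (b t' * hits t t') * M ≡ a t * (b t' * k)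
    times-M t t' = begin
      a t * (b t' * hits t t') * M    ≡⟨ trans (*-assoc (a t) (b t' * hits t t') M) (cong (a t *_) (*-assoc (b t') (hits t t') M)) ⟩
      a t * (b t' * (hits t t' * M))  ≡⟨ cong (λ x → a t * (b t' * (x * M))) (count≡∑ {k} (λ i → ⌊ σ i t' ≟ t ⌋)) ⟨
      a t * (b t' * (count (λ i → ⌊ σ i t' ≟ t ⌋) * M))
        ≡⟨ cong (λ x → a t * (b t' * x)) (uniform t' t) ⟩
      a t * (b t' * k)                ∎

  module _ {k} (σ : Fin k → Fin M → Fin M) (uniform : UniformOnParts σ) (P P' : Subset M) where

    exceeds : Fin k → ℕ
    exceeds i = 𝟙 ⌊ 4 * (∣ P ∣ * ∣ P' ∣) <? pairs (σ i) P P' * M ⌋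

    4∑exceeds≤k : 4 * sum exceeds ≤ k
    4∑exceeds≤k = N[1+4c]≤kc⇒4N≤k (sum exceeds) k (∣ P ∣ * ∣ P' ∣) (begin
      sum exceeds * suc (4 * (∣ P ∣ * ∣ P' ∣))  ≤⟨ markov (λ i → pairs (σ i) P P' * M) _ ⟩
      ∑[ i < k ] (pairs (σ i) P P' * M)        ≡⟨ *-distribʳ-sum M (λ i → pairs (σ i) P P') ⟨
      (∑[ i < k ] pairs (σ i) P P') * M        ≡⟨ ∑pairs*M≡ σ uniform P P' ⟩
      k * (∣ P ∣ * ∣ P' ∣)                      ∎)
      where open ≤-Reasoning

    bound-unless-exceeds : ∀ i → exceeds i ≡ 0 → IntersectionBound (σ i) P P'
    bound-unless-exceeds i exceedsᵢ≡0
      with 4 * (∣ P ∣ * ∣ P' ∣) <? pairs (σ i) P P' * M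
    ... | no ≰ = begin
      ∣ P ∩ image (σ i) P' ∣ * M  ≤⟨ *-monoˡ-≤ M (∣P∩imageP'∣≤pairs (σ i) P P') ⟩
      pairs (σ i) P P' * M       ≤⟨ ≮⇒≥ ≰ ⟩
      4 * (∣ P ∣ * ∣ P' ∣)        ≡⟨ *-assoc 4 ∣ P ∣ ∣ P' ∣ ⟨
      4 * ∣ P ∣ * ∣ P' ∣          ∎
      where open ≤-Reasoning
    bound-unless-exceeds i () | yes _

∃-simultaneous-bounds : ∀ {k MX MY MZ} → 0 < k →
  (σX : Fin k → Fin MX → Fin MX) (σY : Fin k → Fin MY → Fin MY) (σZ : Fin k → Fin MZ → Fin MZ) →
  UniformOnParts σX → UniformOnParts σY → UniformOnParts σZ →
  (PX PX' : Subset MX) (PY PY' : Subset MY) (PZ PZ' : Subset MZ) →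
  ∃ λ i → IntersectionBound (σX i) PX PX'
        × IntersectionBound (σY i) PY PY'
        × IntersectionBound (σZ i) PZ PZ'
∃-simultaneous-bounds 0<k σX σY σZ uniformX uniformY uniformZ PX PX' PY PY' PZ PZ' =
  bounded (∃-common-zero (exceeds σX uniformX PX PX') (exceeds σY uniformY PY PY')
                         (exceeds σZ uniformZ PZ PZ') 0<k
                         (4∑exceeds≤k σX uniformX PX PX') (4∑exceeds≤k σY uniformY PY PY')
                         (4∑exceeds≤k σZ uniformZ PZ PZ'))
  where
  bounded : (∃ λ i → exceeds σX uniformX PX PX' i ≡ 0 × exceeds σY uniformY PY PY' i ≡ 0
                                                      × exceeds σZ uniformZ PZ PZ' i ≡ 0) →
            ∃ λ i → IntersectionBound (σX i) PX PX'
                  × IntersectionBound (σY i) PY PY'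
                  × IntersectionBound (σZ i) PZ PZ'
  bounded (i , okX , okY , okZ) =
    i , bound-unless-exceeds σX uniformX PX PX' i okX
      , bound-unless-exceeds σY uniformY PY PY' i okY
      , bound-unless-exceeds σZ uniformZ PZ PZ' i okZ

mainTheorem5 : ∀ {a : Level} {A : Set a}
    (nX nY nZ MX MY MZ sX sY sZ : ℕ)
    (T : Fin nX → Fin nY → Fin nZ → A)
    (partX : Fin nX → Fin MX) (partY : Fin nY → Fin MY) (partZ : Fin nZ → Fin MZ) →
    1 ≤ sX → 1 ≤ sY → 1 ≤ sZ →
    EqualParts partX sX → EqualParts partY sY → EqualParts partZ sZ →
    (k : ℕ) (G : Fin k → Triple nX nY nZ) →
    DistinctTriples G → 0 < k →
    (cX : ∀ i → RespectsParts partX (πX (G i))) →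
    (cY : ∀ i → RespectsParts partY (πY (G i))) →
    (cZ : ∀ i → RespectsParts partZ (πZ (G i))) →
    (∀ i x y z → T x y z ≡ T (πX (G i) ⟨$⟩ʳ x) (πY (G i) ⟨$⟩ʳ y) (πZ (G i) ⟨$⟩ʳ z)) →
    UniformOnParts (λ i → induced partX (πX (G i)) (cX i)) →
    UniformOnParts (λ i → induced partY (πY (G i)) (cY i)) →
    UniformOnParts (λ i → induced partZ (πZ (G i)) (cZ i)) →
    (PX PX' : Subset MX) (PY PY' : Subset MY) (PZ PZ' : Subset MZ) →
    ∃ λ i → IntersectionBound (induced partX (πX (G i)) (cX i)) PX PX'
          × IntersectionBound (induced partY (πY (G i)) (cY i)) PY PY'
          × IntersectionBound (induced partZ (πZ (G i)) (cZ i)) PZ PZ'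
mainTheorem5 _ _ _ _ _ _ _ _ _ _ partX partY partZ _ _ _ _ _ _ k G _ 0<k cX cY cZ _ =
  ∃-simultaneous-bounds 0<k (λ i → induced partX (πX (G i)) (cX i))
                            (λ i → induced partY (πY (G i)) (cY i))
                            (λ i → induced partZ (πZ (G i)) (cZ i))
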